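{- Let $k$ be an integer and let $T$ be a $(k-1)^+$-branching tree with exactly one vertex $y$ of degree $k-1$, and suppose $y$ has a neighbour $z$ that is not a leaf. Let $T'$ be the tree obtained from $T$ by contracting the edge $yz$ (this $T'$ is $k^+$-branching). Then $b^{\{y\}}(T)\le b(T')$.
   Context: All graphs are finite, simple, connected and undirected. In a tree, vertices of degree $1$ are leaves and all other vertices are internal; for an integer $m$, a tree is $m^+$-branching if every internal vertex has degree at least $m$. Contracting an edge $yz$ means deleting $y$ and adding an edge $zx$ for every neighbour $x\neq z$ of $y$. Graph burning: the process proceeds in discrete rounds; in round $i$ a vertex $b_i$ (a source, possibly already burned) is chosen and burned, and simultaneously every unburned neighbour of a vertex burned by the end of round $i-1$ becomes burned; burned vertices stay burned. A sequence $(b_1,\dots,b_m)$ is a burning sequence if all vertices are burned after round $m$; the burning number $b(G)$ is the minimum length of a burning sequence. Modified burning: for $U\subseteq V(G)$ and vertices $x_1,\dots,x_m$, the sequence $(U\cup\{x_1\},x_2,\dots,x_m)$ burns all vertices of $U\cup\{x_1\}$ in round $1$ and proceeds as in ordinary burning in rounds $i\ge 2$ (choosing source $x_i$); it is a modified burning sequence if all vertices are burned after round $m$. The modified burning number $b^U(G)$ is the minimum length of a modified burning sequence for $G$ with the given set $U$. -}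

module Defs where

open import Data.Nat using (ℕ; zero; suc; _+_; _≤_)
open import Data.Bool using (Bool; true; false; if_then_else_; _∧_; _∨_; not; T)
open import Data.Fin using (Fin; punchIn; _≟_)
open import Data.List using (List; []; _∷_; length; map; allFin; head; drop; _∷ʳ_)
open import Data.Nat.ListAction using (sum)
open import Data.List.Relation.Unary.Linked using (Linked)
open import Data.List.Relation.Unary.Unique.Propositional using (Unique)
open import Data.Maybe using (just)
open import Data.Product using (Σ; _×_; ∃)
open import Data.Sum using (_⊎_)
open import Data.Empty using (⊥)
open import Relation.Nullary using (¬_)
open import Relation.Nullary.Decidable using (⌊_⌋)
open import Relation.Binary.PropositionalEquality using (_≡_)

Graph : ℕ → Set
Graph n = Fin n → Fin n → Bool

Adj : ∀ {n} → Graph n → Fin n → Fin n → Set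
Adj G u v = T (G u v)

IsSimple : ∀ {n} → Graph n → Set
IsSimple G = (∀ u v → G u v ≡ G v u) × (∀ v → G v v ≡ false)

data Reachable {n} (G : Graph n) : Fin n → Fin n → Set where
  here  : ∀ {v} → Reachable G v v
  there : ∀ {u w v} → Adj G u w → Reachable G w v → Reachable G u v

IsConnected : ∀ {n} → Graph n → Set
IsConnected G = ∀ u v → Reachable G u v

HasCycle : ∀ {n} → Graph n → Set
HasCycle {n} G = Σ (Fin n) λ v → Σ (List (Fin n)) λ rest →
  (2 ≤ length rest) × Unique (v ∷ rest) × Linked (Adj G) ((v ∷ rest) ∷ʳ v)

IsTree : ∀ {n} → Graph n → Set
IsTree G = IsSimple G × IsConnected G × ¬ HasCycle G

degree : ∀ {n} → Graph n → Fin n → ℕ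
degree {n} G v = sum (map (λ u → if G v u then 1 else 0) (allFin n))

IsLeaf : ∀ {n} → Graph n → Fin n → Set
IsLeaf G v = degree G v ≡ 1

Branching : ∀ {n} → ℕ → Graph n → Set
Branching m G = ∀ v → ¬ IsLeaf G v → m ≤ degree G v

-- Contracting the edge yz: delete y, and join z to every neighbour x ≠ z of y.
-- The vertices of the result are the vertices ≠ y, indexed via punchIn y.
contract : ∀ {n} → Graph (suc n) → Fin (suc n) → Fin (suc n) → Graph n
contract G y z a b =
  not ⌊ a ≟ b ⌋ ∧
  (G a' b' ∨ (⌊ a' ≟ z ⌋ ∧ G y b') ∨ (⌊ b' ≟ z ⌋ ∧ G y a'))
  where
  a' = punchIn y a
  b' = punchIn y b

-- The source chosen in round (suc i) is the i-th entry (0-based) of the list.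
SourceAt : ∀ {n} → List (Fin n) → ℕ → Fin n → Set
SourceAt s i v = head (drop i s) ≡ just v

-- Burned i v: vertex v is burned after round i of the (modified) burning process
-- with initial set U (burned in round 1) and sources s.
Burned : ∀ {n} → Graph n → (Fin n → Set) → List (Fin n) → ℕ → Fin n → Set
Burned G U s zero v = ⊥
Burned G U s (suc i) v =
  ((i ≡ 0) × U v) ⊎ SourceAt s i v ⊎ Burned G U s i v
  ⊎ (∃ λ u → Adj G u v × Burned G U s i u)

-- (U ∪ {x₁}, x₂, …, x_m) is a modified burning sequence (s = x₁ ∷ … ∷ x_m)
IsModBurningSeq : ∀ {n} → Graph n → (Fin n → Set) → List (Fin n) → Set
IsModBurningSeq G U s = ∀ v → Burned G U s (length s) v

NoVertex : ∀ {n} → Fin n → Set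
NoVertex _ = ⊥

IsBurningSeq : ∀ {n} → Graph n → List (Fin n) → Set
IsBurningSeq G s = IsModBurningSeq G NoVertex s

IsModBurningNumber : ∀ {n} → Graph n → (Fin n → Set) → ℕ → Set
IsModBurningNumber G U b =
  (Σ (List _) λ s → length s ≡ b × IsModBurningSeq G U s)
  × (∀ s → IsModBurningSeq G U s → b ≤ length s)

IsBurningNumber : ∀ {n} → Graph n → ℕ → Set
IsBurningNumber G b = IsModBurningNumber G NoVertex b

{-# OPTIONS --safe #-}
-- Lift a burning sequence of T' = T / yz to T along punchIn y.  Every edge of
-- T' is either an edge of T or ends in a neighbour of y (a former neighbour of
-- y, or z itself), and y burns from round 1 in the modified process, so each
-- vertex of T' burns in T no later than in T'.
module Submission where

open import Defs
open import Data.Bool using (T; not; _∧_)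
open import Data.Bool.Properties using (T-∧; T-∨)
open import Data.Fin using (Fin; punchIn; punchOut; _≟_)
open import Data.Fin.Properties using (punchIn-punchOut)
open import Data.List using (List; map; length; head; drop)
open import Data.List.Properties using (drop-map; head-map; length-map)
import Data.Maybe as Maybe
open import Data.Nat using (ℕ; zero; suc; _+_; _≤_)
open import Data.Product using (_,_; proj₁; proj₂)
open import Data.Sum using (_⊎_; inj₁; inj₂)
open import Function using (_∘_)
open import Function.Bundles using (Equivalence)
open import Relation.Binary.PropositionalEquality
  using (_≡_; _≢_; refl; sym; cong; subst; module ≡-Reasoning)
open import Relation.Nullary using (¬_; yes; no)
open import Relation.Nullary.Decidable using (⌊_⌋; toWitness)

open Equivalence using (to)

Adj⇒≢ : ∀ {n} {G : Graph n} → IsSimple G → ∀ {u v} → Adj G u v → u ≢ v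
Adj⇒≢ (_ , loopless) {u} uv refl = subst T (loopless u) uv

SourceAt-map : ∀ {m n} (f : Fin m → Fin n) {s i v} →
  SourceAt s i v → SourceAt (map f s) i (f v)
SourceAt-map f {s} {i} {v} src = begin
  head (drop i (map f s))       ≡⟨ cong head (drop-map i s) ⟩
  head (map f (drop i s))       ≡⟨ head-map (drop i s) ⟩
  Maybe.map f (head (drop i s)) ≡⟨ cong (Maybe.map f) src ⟩
  Maybe.just (f v)              ∎
  where open ≡-Reasoning

module _ {n} {G : Graph n} {U : Fin n → Set} {s : List (Fin n)} where

  Burned-suc : ∀ {i v} → Burned G U s i v → Burned G U s (suc i) v
  Burned-suc b = inj₂ (inj₂ (inj₁ b))

  Burned-spread : ∀ {i u v} → Adj G u v → Burned G U s i u → Burned G U s (suc i) v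
  Burned-spread {u = u} uv b = inj₂ (inj₂ (inj₂ (u , uv , b)))

  Burned-initial-suc : ∀ {v} → U v → ∀ i → Burned G U s (suc i) v
  Burned-initial-suc uv zero    = inj₁ (refl , uv)
  Burned-initial-suc uv (suc i) = Burned-suc (Burned-initial-suc uv i)

  -- The witness w only serves to rule out round 0, in which nothing is burned.
  Burned-initial : ∀ {v} → U v → ∀ {i w} → Burned G U s i w → Burned G U s i v
  Burned-initial uv {suc i} _ = Burned-initial-suc uv i

contract-edge : ∀ {n} {G : Graph (suc n)} {y z} → Adj G y z → ∀ {a b} →
  Adj (contract G y z) a b →
  Adj G (punchIn y a) (punchIn y b) ⊎ Adj G y (punchIn y b)
contract-edge {G = G} {y} {z} yz {a} {b} ab
  with to (T-∨ {G (punchIn y a) (punchIn y b)}) (proj₂ (to (T-∧ {not ⌊ a ≟ b ⌋}) ab))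
... | inj₁ a'b' = inj₁ a'b'
... | inj₂ viaY with to (T-∨ {⌊ punchIn y a ≟ z ⌋ ∧ G y (punchIn y b)}) viaY
...   | inj₁ a'≡z∧yb' = inj₂ (proj₂ (to T-∧ a'≡z∧yb'))
...   | inj₂ b'≡z∧ya' =
        inj₂ (subst (Adj G y) (sym (toWitness (proj₁ (to (T-∧ {⌊ punchIn y b ≟ z ⌋}) b'≡z∧ya')))) yz)

module _ {n} {G : Graph (suc n)} {y z} (yz : Adj G y z) {s : List (Fin n)} where

  Burned-contract : ∀ i {v} → Burned (contract G y z) NoVertex s i v →
    Burned G (_≡ y) (map (punchIn y) s) i (punchIn y v)
  Burned-contract zero ()
  Burned-contract (suc i) (inj₁ (_ , ()))
  Burned-contract (suc i) (inj₂ (inj₁ src)) = inj₂ (inj₁ (SourceAt-map (punchIn y) {s} {i} src))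
  Burned-contract (suc i) (inj₂ (inj₂ (inj₁ b))) = Burned-suc (Burned-contract i b)
  Burned-contract (suc i) (inj₂ (inj₂ (inj₂ (u , uv , b)))) with contract-edge {G = G} yz uv
  ... | inj₁ u'v' = Burned-spread u'v' (Burned-contract i b)
  ... | inj₂ yv'  = Burned-spread yv' (Burned-initial refl (Burned-contract i b))

  IsBurningSeq-contract : y ≢ z → IsBurningSeq (contract G y z) s →
    IsModBurningSeq G (_≡ y) (map (punchIn y) s)
  -- y ≢ z only supplies a vertex of the contraction, so that s is non-empty.
  IsBurningSeq-contract y≢z burns w rewrite length-map (punchIn y) s with w ≟ y
  ... | yes refl = Burned-initial refl (Burned-contract (length s) (burns (punchOut y≢z)))
  ... | no w≢y   = subst (Burned G (_≡ y) (map (punchIn y) s) (length s))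
                         (punchIn-punchOut y≢w)
                         (Burned-contract (length s) (burns (punchOut y≢w)))
    where
    y≢w : y ≢ w
    y≢w = w≢y ∘ sym

lemma6 : ∀ {n} (T : Graph (suc n)) (k : ℕ) (y z : Fin (suc n)) →
    IsTree T →
    -- k is an integer; "degree ≥ k - 1" is written k ≤ degree + 1
    (∀ v → ¬ IsLeaf T v → k ≤ degree T v + 1) →
    degree T y + 1 ≡ k →
    (∀ v → degree T v + 1 ≡ k → v ≡ y) →
    Adj T y z →
    ¬ IsLeaf T z →
    ∀ b₁ b₂ →
    IsModBurningNumber T (λ v → v ≡ y) b₁ →
    IsBurningNumber (contract T y z) b₂ →
    b₁ ≤ b₂
lemma6 T k y z (simple , _) _ _ _ yz _ b₁ _ (_ , minimal) ((s , refl , burns) , _) =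
  subst (b₁ ≤_) (length-map (punchIn y) s)
    (minimal _ (IsBurningSeq-contract yz (Adj⇒≢ simple yz) burns))
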